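{- Let $\mathbf{C}$ be an adhesive category which has all pushouts and has final pullback complements of all pairs $(b,c)$ with $c$ a monomorphism. Let $r_1: L_1 \xleftarrow{r_1^- } P_1 \xrightarrow{r_1^+} R_1$ be a rule and $m_1: L_1 \rightarrowtail G_1$ an instance, and let $G_1 \xleftarrow{g_1^- } G_1^- \xrightarrow{g_1^+} G_2$, with $m_1^-: P_1 \rightarrowtail G_1^-$ and $m_1^+: R_1 \rightarrowtail G_2$, be the SqPO rewriting of $G_1$ by $r_1$ through $m_1$. Let $r_2: L_2 \xleftarrow{r_2^- } P_2 \xrightarrow{r_2^+} R_2$ be a rule and $m_2: L_2 \rightarrowtail G_2$ an instance, and let $G_2 \xleftarrow{g_2^- } G_2^- \xrightarrow{g_2^+} G_3$, with $m_2^-: P_2 \rightarrowtail G_2^-$ and $m_2^+: R_2 \rightarrowtail G_3$, be the SqPO rewriting of $G_2$ by $r_2$ through $m_2$. Assume both of these rewritings are reversible. Construct: (1) the pullback $R_1 \xleftarrow{x} D \xrightarrow{y} L_2$ of $m_1^+$ and $m_2$; (2) the pushout $R_1 \xrightarrow{r_1^H} H \xleftarrow{l_2^H} L_2$ of $x$ and $y$, and the unique arrow $m^H: H \to G_2$ with $m^H\circ r_1^H = m_1^+$, $m^H \circ l_2^H = m_2$; (3) the final pullback complement $P_1 \xrightarrow{p_1^H} P_1^H \xrightarrow{h_1^+} H$ of $(r_1^+, r_1^H)$ and the final pullback complement $P_2 \xrightarrow{p_2^H} P_2^H \xrightarrow{h_2^- } H$ of $(r_2^-, l_2^H)$; (4)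 the pushout $L_1 \xrightarrow{l_1^H} L \xleftarrow{h_1^- } P_1^H$ of $r_1^-$ and $p_1^H$, and the pushout $R_2 \xrightarrow{r_2^H} R \xleftarrow{h_2^+} P_2^H$ of $r_2^+$ and $p_2^H$; (5) the pullback $P_1^H \xleftarrow{p'} P \xrightarrow{p''} P_2^H$ of $h_1^+$ and $h_2^-$. Let $r: L \xleftarrow{h_1^-\circ p'} P \xrightarrow{h_2^+ \circ p''} R$ be the composed rule. Let $m_1^H: P_1^H \to G_1^-$ be the unique arrow with $m_1^H \circ p_1^H = m_1^-$ and $g_1^+ \circ m_1^H = m^H \circ h_1^+$, and let $m: L \to G_1$ be the unique arrow with $m \circ l_1^H = m_1$ and $m \circ h_1^- = g_1^- \circ m_1^H$ (a monomorphism). Then the SqPO rewriting of $G_1$ by the composed rule $r$ through the instance $m$ (which produces $G_3$) is reversible.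
   Context: A final pullback complement of a pair of arrows $b: A \to B$, $c: B \to C$ is a pair $a: A \to D$, $d: D \to C$ with $c \circ b = d \circ a$ such that this square is a pullback, and such that for every pullback square $c \circ b' = d' \circ a'$ (with $a': A' \to D'$, $b': A' \to B$, $d': D' \to C$) and every $e: A' \to A$ with $b \circ e = b'$ there is a unique $g: D' \to D$ with $g \circ a' = a \circ e$ and $d \circ g = d'$. A rule is a span $L \xleftarrow{r^- } P \xrightarrow{r^+} R$ in $\mathbf{C}$; an instance of it in an object $G$ is a monomorphism $m: L \rightarrowtail G$. The sesqui-pushout (SqPO) rewriting of $G$ by the rule through $m$ consists of: a final pullback complement $P \xrightarrow{m^- } G^- \xrightarrow{g^- } G$ of $(r^-, m)$, followed by the pushout $G^- \xrightarrow{g^+} G^+ \xleftarrow{m^+} R$ of $m^-$ and $r^+$; $G^+$ is the result and $m^+$ the right-hand side instance. Such a rewriting is reversible if the square $m\circ r^- = g^- \circ m^-$ is also a pushout and $(m^-, g^+)$ is also a final pullback complement of $(r^+, m^+)$. -}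

module Defs where

open import Level using (Level; _⊔_) renaming (suc to lsuc)
open import Relation.Binary.PropositionalEquality using (_≡_)
open import Data.Product using (Σ; _×_; _,_)

record Category (o ℓ : Level) : Set (lsuc (o ⊔ ℓ)) where
  infixr 9 _∘_
  field
    Obj       : Set o
    Hom       : Obj → Obj → Set ℓ
    id        : ∀ {A} → Hom A A
    _∘_       : ∀ {A B C} → Hom B C → Hom A B → Hom A C
    assoc     : ∀ {A B C D} (f : Hom A B) (g : Hom B C) (h : Hom C D) →
                (h ∘ g) ∘ f ≡ h ∘ (g ∘ f)
    identityˡ : ∀ {A B} (f : Hom A B) → id ∘ f ≡ f
    identityʳ : ∀ {A B} (f : Hom A B) → f ∘ id ≡ f

module Notions {o ℓ : Level} (C : Category o ℓ) where
  open Category C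

  Mono : ∀ {A B} → Hom A B → Set (o ⊔ ℓ)
  Mono {A} f = ∀ {X} (g h : Hom X A) → f ∘ g ≡ f ∘ h → g ≡ h

  IsPullback : ∀ {A B C D} → Hom B D → Hom C D → Hom A B → Hom A C → Set (o ⊔ ℓ)
  IsPullback {A} {B} {C} f g p q =
    (f ∘ p ≡ g ∘ q) ×
    (∀ {X} (p′ : Hom X B) (q′ : Hom X C) → f ∘ p′ ≡ g ∘ q′ →
       Σ (Hom X A) λ u → ((p ∘ u ≡ p′) × (q ∘ u ≡ q′)) ×
         (∀ (v : Hom X A) → p ∘ v ≡ p′ → q ∘ v ≡ q′ → v ≡ u))

  IsPushout : ∀ {A B C D} → Hom A B → Hom A C → Hom B D → Hom C D → Set (o ⊔ ℓ)
  IsPushout {A} {B} {C} {D} f g p q =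
    (p ∘ f ≡ q ∘ g) ×
    (∀ {X} (p′ : Hom B X) (q′ : Hom C X) → p′ ∘ f ≡ q′ ∘ g →
       Σ (Hom D X) λ u → ((u ∘ p ≡ p′) × (u ∘ q ≡ q′)) ×
         (∀ (v : Hom D X) → v ∘ p ≡ p′ → v ∘ q ≡ q′ → v ≡ u))

  IsFPC : ∀ {A B C D} → Hom A B → Hom B C → Hom A D → Hom D C → Set (o ⊔ ℓ)
  IsFPC {A} {B} {C} {D} b c a d =
    IsPullback c d b a ×
    (∀ {A′ D′} (a′ : Hom A′ D′) (b′ : Hom A′ B) (d′ : Hom D′ C) →
       IsPullback c d′ b′ a′ → (e : Hom A′ A) → b ∘ e ≡ b′ →
       Σ (Hom D′ D) λ g → ((g ∘ a′ ≡ a ∘ e) × (d ∘ g ≡ d′)) ×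
         (∀ (h : Hom D′ D) → h ∘ a′ ≡ a ∘ e → d ∘ h ≡ d′ → h ≡ g))

  HasPullbacks : Set (o ⊔ ℓ)
  HasPullbacks = ∀ {B C D} (f : Hom B D) (g : Hom C D) →
    Σ Obj λ A → Σ (Hom A B) λ p → Σ (Hom A C) λ q → IsPullback f g p q

  HasPushouts : Set (o ⊔ ℓ)
  HasPushouts = ∀ {A B C} (f : Hom A B) (g : Hom A C) →
    Σ Obj λ D → Σ (Hom B D) λ p → Σ (Hom C D) λ q → IsPushout f g p q

  HasPushoutsAlongMonos : Set (o ⊔ ℓ)
  HasPushoutsAlongMonos = ∀ {A B C} (f : Hom A B) (m : Hom A C) → Mono m →
    Σ Obj λ D → Σ (Hom B D) λ p → Σ (Hom C D) λ q → IsPushout f m p q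

  HasFPCsAlongMonos : Set (o ⊔ ℓ)
  HasFPCsAlongMonos = ∀ {A B C} (b : Hom A B) (c : Hom B C) → Mono c →
    Σ Obj λ D → Σ (Hom A D) λ a → Σ (Hom D C) λ d → IsFPC b c a d

  IsVanKampen : ∀ {A B C D} → Hom A B → Hom A C → Hom B D → Hom C D → Set (o ⊔ ℓ)
  IsVanKampen {A} {B} {C} {D} f m g n =
    IsPushout f m g n ×
    (∀ {A′ B′ C′ D′} (f′ : Hom A′ B′) (m′ : Hom A′ C′) (g′ : Hom B′ D′) (n′ : Hom C′ D′)
       (a : Hom A′ A) (b : Hom B′ B) (c : Hom C′ C) (d : Hom D′ D) →
       g′ ∘ f′ ≡ n′ ∘ m′ →
       g ∘ b ≡ d ∘ g′ → n ∘ c ≡ d ∘ n′ →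
       IsPullback f b a f′ → IsPullback m c a m′ →
       (IsPushout f′ m′ g′ n′ → IsPullback g d b g′ × IsPullback n d c n′) ×
       (IsPullback g d b g′ × IsPullback n d c n′ → IsPushout f′ m′ g′ n′))

  Adhesive : Set (o ⊔ ℓ)
  Adhesive =
    HasPullbacks × HasPushoutsAlongMonos ×
    (∀ {A B C D} (f : Hom A B) (m : Hom A C) (g : Hom B D) (n : Hom C D) →
       Mono m → IsPushout f m g n → IsVanKampen f m g n)

  IsSqPO : ∀ {L P R G G⁻ G⁺} (r⁻ : Hom P L) (r⁺ : Hom P R) (m : Hom L G)
           (m⁻ : Hom P G⁻) (g⁻ : Hom G⁻ G) (g⁺ : Hom G⁻ G⁺) (m⁺ : Hom R G⁺) → Set (o ⊔ ℓ)
  IsSqPO r⁻ r⁺ m m⁻ g⁻ g⁺ m⁺ = IsFPC r⁻ m m⁻ g⁻ × IsPushout m⁻ r⁺ g⁺ m⁺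

  Reversible : ∀ {L P R G G⁻ G⁺} (r⁻ : Hom P L) (r⁺ : Hom P R) (m : Hom L G)
               (m⁻ : Hom P G⁻) (g⁻ : Hom G⁻ G) (g⁺ : Hom G⁻ G⁺) (m⁺ : Hom R G⁺) → Set (o ⊔ ℓ)
  Reversible r⁻ r⁺ m m⁻ g⁻ g⁺ m⁺ = IsPushout r⁻ m⁻ m g⁻ × IsFPC r⁺ m⁺ m⁻ g⁺

{-# OPTIONS --safe #-}
module Submission where

open import Defs
open import Level using (Level; _⊔_)
open import Relation.Binary.PropositionalEquality
  using (_≡_; refl; sym; trans; cong; subst; module ≡-Reasoning)
open import Data.Product using (Σ; _×_; _,_; proj₁; proj₂; swap)

-- A reversible SqPO step is a pair of squares each of which is both a final pullback
-- complement and a pushout. Both given steps restrict to H, the union of the comatch of the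
-- first step and the match of the second, which is again a subobject of G₂ by adhesivity:
-- the squares over the interfaces P₁ᴴ and P₂ᴴ are again FPCs and pushouts, giving reversible
-- steps G₁ ⇒ G₂ by L ← P₁ᴴ → H and G₂ ⇒ G₃ by H ← P₂ᴴ → R. These compose: over the pullback P
-- of the interfaces, the pullback of G₁⁻ → G₂ ← G₂⁻ completes each half of the composed rule
-- by a square that is an FPC (by the universal properties around a cube) and a pushout (by
-- van Kampen), and pasting yields a reversible step G₁ ⇒ G₃. As SqPO rewritings are unique
-- up to isomorphism, every SqPO rewriting by the composed rule through m is reversible.

module Squares {o ℓ : Level} (𝒞 : Category o ℓ) where
  open Category 𝒞
  open Notions 𝒞
  open ≡-Reasoning

  private variable
    A B C D E : Obj
    a b c d f g h m p q s t u v : Hom A B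

  infixr 5 _⟩∘_ _∘⟨_

  _⟩∘_ : {g g′ : Hom B C} → g ≡ g′ → (f : Hom A B) → g ∘ f ≡ g′ ∘ f
  eq ⟩∘ f = cong (_∘ f) eq

  _∘⟨_ : {f f′ : Hom A B} → (g : Hom B C) → f ≡ f′ → g ∘ f ≡ g ∘ f′
  g ∘⟨ eq = cong (g ∘_) eq

  ∘-assoc : (h ∘ g) ∘ f ≡ h ∘ (g ∘ f)
  ∘-assoc {h = h} {g = g} {f = f} = assoc f g h

  pullˡ : a ∘ b ≡ c → a ∘ (b ∘ f) ≡ c ∘ f
  pullˡ {f = f} eq = trans (sym ∘-assoc) (eq ⟩∘ f)

  pullʳ : a ∘ b ≡ c → (f ∘ a) ∘ b ≡ f ∘ c
  pullʳ {f = f} eq = trans ∘-assoc (f ∘⟨ eq)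

  extendʳ : a ∘ b ≡ c ∘ d → a ∘ (b ∘ f) ≡ c ∘ (d ∘ f)
  extendʳ {f = f} eq = trans (sym ∘-assoc) (trans (eq ⟩∘ f) ∘-assoc)

  extendˡ : a ∘ b ≡ c ∘ d → (f ∘ a) ∘ b ≡ (f ∘ c) ∘ d
  extendˡ {f = f} eq = trans ∘-assoc (trans (f ∘⟨ eq) (sym ∘-assoc))

  cancelˡ : a ∘ b ≡ id → a ∘ (b ∘ f) ≡ f
  cancelˡ {f = f} eq = trans (pullˡ eq) (identityˡ f)

  cancelʳ : a ∘ b ≡ id → (f ∘ a) ∘ b ≡ f
  cancelʳ {f = f} eq = trans (pullʳ eq) (identityʳ f)

  id-comm : f ∘ id ≡ id ∘ f
  id-comm {f = f} = trans (identityʳ f) (sym (identityˡ f))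

  IsPullback-sym : IsPullback f g p q → IsPullback g f q p
  IsPullback-sym (comm , universal) = sym comm , λ p′ q′ eq →
    let (u , (pu , qu) , unique) = universal q′ p′ (sym eq)
    in u , (qu , pu) , λ v qv pv → unique v pv qv

  IsPushout-sym : IsPushout f g p q → IsPushout g f q p
  IsPushout-sym (comm , universal) = sym comm , λ p′ q′ eq →
    let (u , (up , uq) , unique) = universal q′ p′ (sym eq)
    in u , (uq , up) , λ v vq vp → unique v vp vq

  pullback-jointly-monic : IsPullback f g p q → p ∘ u ≡ p ∘ v → q ∘ u ≡ q ∘ v → u ≡ v
  pullback-jointly-monic {p = p} {q = q} {u = u} {v = v} (comm , universal) pu≡pv qu≡qv =
    let (_ , _ , unique) = universal (p ∘ u) (q ∘ u) (extendʳ comm)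
    in trans (unique u refl refl) (sym (unique v (sym pu≡pv) (sym qu≡qv)))

  pushout-jointly-epic : IsPushout f g p q → u ∘ p ≡ v ∘ p → u ∘ q ≡ v ∘ q → u ≡ v
  pushout-jointly-epic {p = p} {q = q} {u = u} {v = v} (comm , universal) up≡vp uq≡vq =
    let (_ , _ , unique) = universal (u ∘ p) (u ∘ q) (extendˡ comm)
    in trans (unique u refl refl) (sym (unique v (sym up≡vp) (sym uq≡vq)))

  IsPullback-resp : ∀ {f f′ : Hom B D} {g g′ : Hom C D} {p p′ : Hom A B} {q q′ : Hom A C} →
    f ≡ f′ → g ≡ g′ → p ≡ p′ → q ≡ q′ → IsPullback f g p q → IsPullback f′ g′ p′ q′
  IsPullback-resp refl refl refl refl pb = pb

  IsPushout-resp : ∀ {f f′ : Hom A B} {g g′ : Hom A C} {p p′ : Hom B D} {q q′ : Hom C D} →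
    f ≡ f′ → g ≡ g′ → p ≡ p′ → q ≡ q′ → IsPushout f g p q → IsPushout f′ g′ p′ q′
  IsPushout-resp refl refl refl refl po = po

  IsFPC-resp : ∀ {b b′ : Hom A B} {c c′ : Hom B C} {a a′ : Hom A D} {d d′ : Hom D C} →
    b ≡ b′ → c ≡ c′ → a ≡ a′ → d ≡ d′ → IsFPC b c a d → IsFPC b′ c′ a′ d′
  IsFPC-resp refl refl refl refl fpc = fpc

  mono⇒IsPullback-id : Mono f → IsPullback f f id id
  mono⇒IsPullback-id f-mono = refl , λ p′ q′ eq →
    p′ , (identityˡ p′ , trans (identityˡ p′) (f-mono p′ q′ eq)) ,
    λ v idv _ → trans (sym (identityˡ v)) idv

  IsPullback-id⇒mono : IsPullback f f id id → Mono f
  IsPullback-id⇒mono (_ , universal) g h eq =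
    let (_ , (u≡g , u≡h) , _) = universal g h eq in trans (sym u≡g) u≡h

  mono-pullback-stable : IsPullback f g p q → Mono f → Mono q
  mono-pullback-stable {f = f} {g = g} {p = p} {q = q} pb f-mono u v qu≡qv =
    pullback-jointly-monic pb (f-mono (p ∘ u) (p ∘ v) fpu≡fpv) qu≡qv
    where
    fpu≡fpv : f ∘ (p ∘ u) ≡ f ∘ (p ∘ v)
    fpu≡fpv = begin
      f ∘ (p ∘ u)  ≡⟨ extendʳ (proj₁ pb) ⟩
      g ∘ (q ∘ u)  ≡⟨ g ∘⟨ qu≡qv ⟩
      g ∘ (q ∘ v)  ≡⟨ extendʳ (sym (proj₁ pb)) ⟩
      f ∘ (p ∘ v)  ∎

  IsPullback-postcompose-mono : Mono m → IsPullback f g p q → IsPullback (m ∘ f) (m ∘ g) p q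
  IsPullback-postcompose-mono m-mono (comm , universal) =
    extendˡ comm , λ p′ q′ eq → universal p′ q′ (m-mono _ _ (trans (sym ∘-assoc) (trans eq ∘-assoc)))

  mono⇒IsPullback-∘ : Mono m → IsPullback (m ∘ f) m id f
  mono⇒IsPullback-∘ {m = m} {f = f} m-mono = identityʳ (m ∘ f) , λ p′ q′ eq →
    p′ , (identityˡ p′ , m-mono (f ∘ p′) q′ (trans (sym ∘-assoc) eq)) ,
    λ v idv _ → trans (sym (identityˡ v)) idv

  IsPullback-id : IsPullback f id id f
  IsPullback-id = id-comm , λ p′ q′ eq →
    p′ , (identityˡ p′ , trans eq (identityˡ q′)) , λ v idv _ → trans (sym (identityˡ v)) idv

  IsPushout-id : IsPushout f id id f
  IsPushout-id = sym id-comm , λ p′ q′ eq →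
    p′ , (identityʳ p′ , trans eq (identityʳ q′)) , λ v vid _ → trans (sym (identityʳ v)) vid

  pullback-paste : IsPullback f g p q → IsPullback q h s t → IsPullback f (g ∘ h) (p ∘ s) t
  pullback-paste {g = g} {p = p} {h = h} {s = s} (comm₁ , universal₁) (comm₂ , universal₂) =
    trans (extendʳ comm₁) (trans (g ∘⟨ comm₂) (sym ∘-assoc)) ,
    λ p′ q′ eq →
      let (u₁ , (pu₁ , qu₁) , unique₁) = universal₁ p′ (h ∘ q′) (trans eq ∘-assoc)
          (u₂ , (su₂ , tu₂) , unique₂) = universal₂ u₁ q′ qu₁
      in u₂ , (trans ∘-assoc (trans (p ∘⟨ su₂) pu₁) , tu₂) ,
         λ v psv tv → unique₂ v
           (unique₁ (s ∘ v) (trans (sym ∘-assoc) psv) (trans (extendʳ comm₂) (h ∘⟨ tv))) tv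

  pullback-decompose : IsPullback f (g ∘ h) (p ∘ s) t → IsPullback f g p q → q ∘ s ≡ h ∘ t →
                       IsPullback q h s t
  pullback-decompose {g = g} {h = h} {p = p} {s = s} (_ , universal) right comm =
    comm , λ u v eq →
      let (w , (psw , tw) , unique) = universal (p ∘ u) v
            (trans (extendʳ (proj₁ right)) (trans (g ∘⟨ eq) (sym ∘-assoc)))
          sw≡u : s ∘ w ≡ u
          sw≡u = pullback-jointly-monic right (trans (sym ∘-assoc) psw)
                   (trans (extendʳ comm) (trans (h ∘⟨ tw) (sym eq)))
      in w , (sw≡u , tw) , λ w′ sw′ tw′ → unique w′ (trans ∘-assoc (p ∘⟨ sw′)) tw′

  pushout-paste : IsPushout f g p q → IsPushout h p s t → IsPushout (h ∘ f) g s (t ∘ q)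
  pushout-paste {q = q} {h = h} {t = t} (comm₁ , universal₁) (comm₂ , universal₂) =
    trans (pullˡ comm₂) (trans (pullʳ comm₁) (sym ∘-assoc)) ,
    λ s′ t′ eq →
      let (u₁ , (u₁p , u₁q) , unique₁) = universal₁ (s′ ∘ h) t′ (trans ∘-assoc eq)
          (u₂ , (u₂s , u₂t) , unique₂) = universal₂ s′ u₁ (sym u₁p)
      in u₂ , (u₂s , trans (sym ∘-assoc) (trans (u₂t ⟩∘ q) u₁q)) ,
         λ v vs vtq → unique₂ v vs
           (unique₁ (v ∘ t) (trans (extendˡ (sym comm₂)) (vs ⟩∘ h)) (trans ∘-assoc vtq))

  pushout-decompose : IsPushout (h ∘ f) g s (t ∘ q) → IsPushout f g p q → s ∘ h ≡ t ∘ p →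
                      IsPushout h p s t
  pushout-decompose {h = h} {t = t} {q = q} (_ , universal) left comm =
    comm , λ s′ t′ eq →
      let (w , (ws , wtq) , unique) = universal s′ (t′ ∘ q)
            (trans (pullˡ eq) (trans (pullʳ (proj₁ left)) (sym ∘-assoc)))
          wt≡t′ : w ∘ t ≡ t′
          wt≡t′ = pushout-jointly-epic left
                    (trans (extendˡ (sym comm)) (trans (ws ⟩∘ h) eq)) (trans ∘-assoc wtq)
      in w , (ws , wt≡t′) , λ w′ w′s w′t → unique w′ w′s (trans (sym ∘-assoc) (w′t ⟩∘ q))

  record _≅_ (A B : Obj) : Set ℓ where
    field
      to      : Hom A B
      from    : Hom B A
      from∘to : from ∘ to ≡ id
      to∘from : to ∘ from ≡ id
  open _≅_

  ≅-sym : A ≅ B → B ≅ A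
  ≅-sym φ = record { to = from φ ; from = to φ ; from∘to = to∘from φ ; to∘from = from∘to φ }

  iso-mono : (φ : A ≅ B) → Mono (to φ)
  iso-mono φ _ _ eq = trans (sym (cancelˡ (from∘to φ))) (trans (from φ ∘⟨ eq) (cancelˡ (from∘to φ)))

  fpc-endo-id : IsFPC b c a d → h ∘ a ≡ a → d ∘ h ≡ d → h ≡ id
  fpc-endo-id {b = b} {a = a} {d = d} {h = h} (pb , universal) ha dh =
    let (_ , _ , unique) = universal a b d pb id (identityʳ b)
    in trans (unique h (trans ha (sym (identityʳ a))) dh) (sym (unique id (sym id-comm) (identityʳ d)))

  fpc-unique : ∀ {D′} {a′ : Hom A D′} {d′ : Hom D′ C} → IsFPC b c a d → IsFPC b c a′ d′ →
               Σ (D′ ≅ D) λ φ → (to φ ∘ a′ ≡ a) × (d ∘ to φ ≡ d′)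
  fpc-unique {b = b} {a = a} {d = d} {a′ = a′} {d′ = d′} fpc@(pb , universal) fpc′@(pb′ , universal′) =
    let (φ , (φa′ , dφ) , _) = universal a′ b d′ pb′ id (identityʳ b)
        (ψ , (ψa , d′ψ) , _) = universal′ a b d pb id (identityʳ b)
        φa′≡a = trans φa′ (identityʳ a)
        ψa≡a′ = trans ψa (identityʳ a′)
    in record
         { to      = φ
         ; from    = ψ
         ; from∘to = fpc-endo-id fpc′ (trans ∘-assoc (trans (ψ ∘⟨ φa′≡a) ψa≡a′)) (trans (pullˡ d′ψ) dφ)
         ; to∘from = fpc-endo-id fpc (trans ∘-assoc (trans (φ ∘⟨ ψa≡a′) φa′≡a)) (trans (pullˡ dφ) d′ψ)
         } ,
       φa′≡a , dφ

  pushout-unique : ∀ {E} {p′ : Hom B E} {q′ : Hom C E} → IsPushout f g p q → IsPushout f g p′ q′ →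
                   Σ (D ≅ E) λ θ → (to θ ∘ p ≡ p′) × (to θ ∘ q ≡ q′)
  pushout-unique {p = p} {q = q} {p′ = p′} {q′ = q′} po@(comm , universal) po′@(comm′ , universal′) =
    let (θ , (θp , θq) , _) = universal p′ q′ comm′
        (θ′ , (θ′p′ , θ′q′) , _) = universal′ p q comm
    in record
         { to      = θ
         ; from    = θ′
         ; from∘to = pushout-jointly-epic po (trans (pullʳ θp) (trans θ′p′ (sym (identityˡ p))))
                                             (trans (pullʳ θq) (trans θ′q′ (sym (identityˡ q))))
         ; to∘from = pushout-jointly-epic po′ (trans (pullʳ θ′p′) (trans θp (sym (identityˡ p′))))
                                              (trans (pullʳ θ′q′) (trans θq (sym (identityˡ q′))))
         } ,
       θp , θq

  IsFPC-iso-complement : IsFPC b c a d → (φ : D ≅ E) → IsFPC b c (to φ ∘ a) (d ∘ from φ)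
  IsFPC-iso-complement {d = d} ((comm , universal) , final) φ =
    (trans comm (sym (trans ∘-assoc (d ∘⟨ cancelˡ (from∘to φ)))) ,
      λ p′ q′ eq →
        let (u , (bu , au) , unique) = universal p′ (from φ ∘ q′) (trans eq ∘-assoc)
        in u , (bu , trans ∘-assoc (trans (to φ ∘⟨ au) (cancelˡ (to∘from φ)))) ,
           λ v bv φav → unique v bv (trans (sym (cancelˡ (from∘to φ))) (from φ ∘⟨ trans (sym ∘-assoc) φav))) ,
    λ a′ b′ d′ pb′ e be →
      let (g , (ga′ , dg) , unique) = final a′ b′ d′ pb′ e be
      in to φ ∘ g , (extendˡ ga′ , trans ∘-assoc (trans (d ∘⟨ cancelˡ (from∘to φ)) dg)) ,
         λ h ha′ dφ⁻¹h →
           let φ⁻¹h≡g = unique (from φ ∘ h)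
                          (trans ∘-assoc (trans (from φ ∘⟨ ha′) (trans (from φ ∘⟨ ∘-assoc) (cancelˡ (from∘to φ)))))
                          (trans (sym ∘-assoc) dφ⁻¹h)
           in trans (sym (cancelˡ (to∘from φ))) (to φ ∘⟨ φ⁻¹h≡g)

  IsFPC-iso-target : IsFPC b c a d → (θ : C ≅ E) → IsFPC b (to θ ∘ c) a (to θ ∘ d)
  IsFPC-iso-target {c = c} (pb , final) θ =
    IsPullback-postcompose-mono (iso-mono θ) pb ,
    λ a′ b′ d′ pb′ e be →
      let pb″ : IsPullback c (from θ ∘ d′) b′ a′
          pb″ = IsPullback-resp (cancelˡ (from∘to θ)) refl refl refl
                  (IsPullback-postcompose-mono (iso-mono (≅-sym θ)) pb′)
          (g , (ga′ , dg) , unique) = final a′ b′ (from θ ∘ d′) pb″ e be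
      in g , (ga′ , trans ∘-assoc (trans (to θ ∘⟨ dg) (cancelˡ (to∘from θ)))) ,
         λ h ha′ θdh → unique h ha′ (trans (sym (cancelˡ (from∘to θ))) (from θ ∘⟨ trans (sym ∘-assoc) θdh))

  IsPushout-iso-leg : IsPushout f g p q → (φ : C ≅ E) → IsPushout f (to φ ∘ g) p (q ∘ from φ)
  IsPushout-iso-leg {q = q} (comm , universal) φ =
    trans comm (sym (trans ∘-assoc (q ∘⟨ cancelˡ (from∘to φ)))) ,
    λ s t eq →
      let (u , (up , uq) , unique) = universal s (t ∘ to φ) (trans eq (sym ∘-assoc))
      in u , (up , trans (sym ∘-assoc) (trans (uq ⟩∘ from φ) (cancelʳ (to∘from φ)))) ,
         λ v vp vqφ⁻¹ → unique v vp (trans (v ∘⟨ sym (cancelʳ (from∘to φ))) (trans (sym ∘-assoc) (vqφ⁻¹ ⟩∘ to φ)))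

  -- An FPC square IsFPC b c a d is drawn with b on top and c on the right: ʰ pastes squares
  -- side by side (composing b), ᵛ stacks them (composing c).
  fpc-pasteʰ : ∀ {A₁ A₂ D₁ D₂} {b₁ : Hom A₁ A₂} {a₂ : Hom A₂ D₂} {a₁ : Hom A₁ D₁} {e : Hom D₁ D₂}
               {b₂ : Hom A₂ B} {c : Hom B C} {d₂ : Hom D₂ C} →
               IsFPC b₁ a₂ a₁ e → IsFPC b₂ c a₂ d₂ → IsFPC (b₂ ∘ b₁) c a₁ (d₂ ∘ e)
  fpc-pasteʰ {b₁ = b₁} {a₂ = a₂} {e = e} {d₂ = d₂} (pb₁ , final₁) (pb₂ , final₂) =
    pullback-paste pb₂ pb₁ ,
    λ a′ b′ d′ pb′ e′ be′ →
      let (g₂ , (g₂a′ , d₂g₂) , unique₂) = final₂ a′ b′ d′ pb′ (b₁ ∘ e′) (trans (sym ∘-assoc) be′)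
          left : IsPullback a₂ g₂ (b₁ ∘ e′) a′
          left = pullback-decompose
                   (IsPullback-resp refl (sym d₂g₂) (trans (sym be′) ∘-assoc) refl pb′) pb₂ (sym g₂a′)
          (g₁ , (g₁a′ , eg₁) , unique₁) = final₁ a′ (b₁ ∘ e′) g₂ left e′ refl
      in g₁ , (g₁a′ , trans ∘-assoc (trans (d₂ ∘⟨ eg₁) d₂g₂)) ,
         λ h ha′ dh → unique₁ h ha′
           (unique₂ (e ∘ h) (trans ∘-assoc (trans (e ∘⟨ ha′) (extendʳ (sym (proj₁ pb₁))))) (trans (sym ∘-assoc) dh))

  fpc-pasteᵛ : HasPullbacks → ∀ {B₂ D₁ D₂} {b : Hom A B} {c₁ : Hom B B₂} {a₁ : Hom A D₁} {d₁ : Hom D₁ B₂}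
               {c₂ : Hom B₂ C} {a₂ : Hom D₁ D₂} {d₂ : Hom D₂ C} →
               IsFPC b c₁ a₁ d₁ → IsFPC d₁ c₂ a₂ d₂ → Mono a₂ → IsFPC b (c₂ ∘ c₁) (a₂ ∘ a₁) d₂
  fpc-pasteᵛ pullbacks {c₁ = c₁} {a₁ = a₁} {c₂ = c₂} {a₂ = a₂}
             (pb₁ , final₁) (pb₂ , final₂) a₂-mono =
    IsPullback-sym (pullback-paste (IsPullback-sym pb₂) (IsPullback-sym pb₁)) ,
    λ a′ b′ d′ pb′ e be →
      let (_ , s , t , pbₛₜ) = pullbacks c₂ d′
          (k , (sk , tk) , _) = proj₂ pbₛₜ (c₁ ∘ b′) a′ (trans (sym ∘-assoc) (proj₁ pb′))
          upper : IsPullback c₁ s b′ k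
          upper = IsPullback-sym (pullback-decompose
                    (IsPullback-resp refl refl (sym tk) refl (IsPullback-sym pb′)) (IsPullback-sym pbₛₜ) sk)
          (g₁ , (g₁k , d₁g₁) , unique₁) = final₁ k b′ s upper e be
          (g , (gt , d₂g) , unique) = final₂ t s d′ pbₛₜ g₁ d₁g₁
          ga′ : g ∘ a′ ≡ (a₂ ∘ a₁) ∘ e
          ga′ = begin
            g ∘ a′          ≡⟨ g ∘⟨ sym tk ⟩
            g ∘ (t ∘ k)     ≡⟨ pullˡ gt ⟩
            (a₂ ∘ g₁) ∘ k   ≡⟨ pullʳ g₁k ⟩
            a₂ ∘ (a₁ ∘ e)   ≡⟨ sym ∘-assoc ⟩
            (a₂ ∘ a₁) ∘ e   ∎
      in g , (ga′ , d₂g) ,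
         λ h ha′ d₂h →
           let (x , (d₁x , a₂x) , _) = proj₂ pb₂ s (h ∘ t) (trans (proj₁ pbₛₜ) (trans (sym d₂h ⟩∘ t) ∘-assoc))
               xk≡a₁e : x ∘ k ≡ a₁ ∘ e
               xk≡a₁e = a₂-mono _ _ (begin
                 a₂ ∘ (x ∘ k)    ≡⟨ pullˡ a₂x ⟩
                 (h ∘ t) ∘ k     ≡⟨ pullʳ tk ⟩
                 h ∘ a′          ≡⟨ ha′ ⟩
                 (a₂ ∘ a₁) ∘ e   ≡⟨ ∘-assoc ⟩
                 a₂ ∘ (a₁ ∘ e)   ∎)
           in unique h (trans (sym a₂x) (a₂ ∘⟨ unique₁ x xk≡a₁e d₁x)) d₂h

  fpc-decomposeᵛ-upper : ∀ {B₂ D₁} {b : Hom A B} {c₁ : Hom B B₂} {c₂ : Hom B₂ C} {a : Hom A D} {d : Hom D C}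
                         {a₁ : Hom A D₁} {d₁ : Hom D₁ B₂} {k : Hom D₁ D} →
                         IsFPC b (c₂ ∘ c₁) a d → IsPullback c₁ d₁ b a₁ → IsPullback c₂ d d₁ k →
                         Mono c₂ → Mono k → k ∘ a₁ ≡ a → IsFPC b c₁ a₁ d₁
  fpc-decomposeᵛ-upper {c₂ = c₂} {a₁ = a₁} {k = k} (_ , final) upper lower c₂-mono k-mono ka₁ =
    upper ,
    λ a′ b′ d′ pb′ e be →
      let (g₀ , (g₀a′ , dg₀) , unique₀) = final a′ b′ (c₂ ∘ d′) (IsPullback-postcompose-mono c₂-mono pb′) e be
          (g , (d₁g , kg) , unique) = proj₂ lower d′ g₀ (sym dg₀)
          ga′ : g ∘ a′ ≡ a₁ ∘ e
          ga′ = k-mono _ _ (trans (pullˡ kg) (trans g₀a′ (trans (sym ka₁ ⟩∘ e) ∘-assoc)))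
      in g , (ga′ , d₁g) ,
         λ h ha′ d₁h → unique h d₁h
           (unique₀ (k ∘ h) (trans ∘-assoc (trans (k ∘⟨ ha′) (pullˡ ka₁)))
                            (trans (pullˡ (sym (proj₁ lower))) (pullʳ d₁h)))

  fpc-decomposeᵛ-lower : HasPullbacks → HasFPCsAlongMonos →
                         ∀ {B₂ D₁} {b : Hom A B} {c₁ : Hom B B₂} {a₁ : Hom A D₁} {d₁ : Hom D₁ B₂}
                         {c₂ : Hom B₂ C} {a : Hom A D} {d : Hom D C} {k : Hom D₁ D} →
                         IsFPC b c₁ a₁ d₁ → Mono c₂ → IsFPC b (c₂ ∘ c₁) a d →
                         k ∘ a₁ ≡ a → d ∘ k ≡ c₂ ∘ d₁ → IsFPC d₁ c₂ k d
  fpc-decomposeᵛ-lower pullbacks fpcs {b = b} {a₁ = a₁} {d₁ = d₁} {c₂ = c₂} {a = a} {k = k}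
                       upper c₂-mono outer ka₁ dk =
    let (_ , a₂ , d₂ , lower) = fpcs d₁ c₂ c₂-mono
        (φ , φa₂a₁ , dφ) = fpc-unique outer
                             (fpc-pasteᵛ pullbacks upper lower (mono-pullback-stable (proj₁ lower) c₂-mono))
        (_ , _ , unique) = proj₂ outer a₁ b (c₂ ∘ d₁)
                             (IsPullback-postcompose-mono c₂-mono (proj₁ upper)) id (identityʳ b)
        φa₂≡k : to φ ∘ a₂ ≡ k
        φa₂≡k = trans (unique (to φ ∘ a₂) (trans ∘-assoc (trans φa₂a₁ (sym (identityʳ a))))
                                          (trans (pullˡ dφ) (sym (proj₁ (proj₁ lower)))))
                      (sym (unique k (trans ka₁ (sym (identityʳ a))) dk))
    in IsFPC-resp refl refl φa₂≡k (trans (sym dφ ⟩∘ from φ) (cancelʳ (to∘from φ)))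
         (IsFPC-iso-complement lower φ)

  pushout-decomposeᵛ-lower : ∀ {B₂ D₁} {b : Hom A B} {c₁ : Hom B B₂} {c₂ : Hom B₂ C} {a : Hom A D}
                             {d : Hom D C} {a₁ : Hom A D₁} {d₁ : Hom D₁ B₂} {k : Hom D₁ D} →
                             IsPushout b a (c₂ ∘ c₁) d → IsPushout b a₁ c₁ d₁ →
                             k ∘ a₁ ≡ a → d ∘ k ≡ c₂ ∘ d₁ → IsPushout d₁ k c₂ d
  pushout-decomposeᵛ-lower outer upper ka₁ dk =
    IsPushout-sym (pushout-decompose (IsPushout-resp (sym ka₁) refl refl refl (IsPushout-sym outer))
                                     (IsPushout-sym upper) dk)

  IsFPCPushout : Hom A B → Hom B C → Hom A D → Hom D C → Set (o ⊔ ℓ)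
  IsFPCPushout b c a d = IsFPC b c a d × IsPushout b a c d

  fpc-pushout-pasteʰ : ∀ {A₁ A₂ D₁ D₂} {b₁ : Hom A₁ A₂} {a₂ : Hom A₂ D₂} {a₁ : Hom A₁ D₁} {e : Hom D₁ D₂}
                       {b₂ : Hom A₂ B} {c : Hom B C} {d₂ : Hom D₂ C} →
                       IsFPCPushout b₁ a₂ a₁ e → IsFPCPushout b₂ c a₂ d₂ → IsFPCPushout (b₂ ∘ b₁) c a₁ (d₂ ∘ e)
  fpc-pushout-pasteʰ (fpc₁ , po₁) (fpc₂ , po₂) = fpc-pasteʰ fpc₁ fpc₂ , pushout-paste po₁ po₂

  -- A reversible SqPO rewriting, in a form symmetric in its two squares: the reverse
  -- rewriting is obtained by swap.
  ReversibleSqPO : ∀ {L P R G G⁻ G⁺} (r⁻ : Hom P L) (r⁺ : Hom P R) (m : Hom L G)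
                   (m⁻ : Hom P G⁻) (g⁻ : Hom G⁻ G) (g⁺ : Hom G⁻ G⁺) (m⁺ : Hom R G⁺) → Set (o ⊔ ℓ)
  ReversibleSqPO r⁻ r⁺ m m⁻ g⁻ g⁺ m⁺ = IsFPCPushout r⁻ m m⁻ g⁻ × IsFPCPushout r⁺ m⁺ m⁻ g⁺

  module _ {L P R G : Obj} {r⁻ : Hom P L} {r⁺ : Hom P R} {m : Hom L G} where

    reversibleSqPO : ∀ {G⁻ G⁺} {m⁻ : Hom P G⁻} {g⁻ : Hom G⁻ G} {g⁺ : Hom G⁻ G⁺} {m⁺ : Hom R G⁺} →
                     IsSqPO r⁻ r⁺ m m⁻ g⁻ g⁺ m⁺ → Reversible r⁻ r⁺ m m⁻ g⁻ g⁺ m⁺ →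
                     ReversibleSqPO r⁻ r⁺ m m⁻ g⁻ g⁺ m⁺
    reversibleSqPO (fpc⁻ , po⁺) (po⁻ , fpc⁺) = (fpc⁻ , po⁻) , (fpc⁺ , IsPushout-sym po⁺)

    reversible-invariant : ∀ {G⁻ G⁺ H⁻ H⁺} {n⁻ : Hom P H⁻} {k⁻ : Hom H⁻ G} {k⁺ : Hom H⁻ H⁺} {n⁺ : Hom R H⁺}
                           {m⁻ : Hom P G⁻} {g⁻ : Hom G⁻ G} {g⁺ : Hom G⁻ G⁺} {m⁺ : Hom R G⁺} →
                           IsSqPO r⁻ r⁺ m n⁻ k⁻ k⁺ n⁺ → ReversibleSqPO r⁻ r⁺ m m⁻ g⁻ g⁺ m⁺ →
                           Reversible r⁻ r⁺ m n⁻ k⁻ k⁺ n⁺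
    reversible-invariant (fpc⁻ , po⁺) ((fpc₀⁻ , po₀⁻) , (fpc₀⁺ , po₀⁺)) =
      let (φ , φm⁻ , k⁻φ) = fpc-unique fpc⁻ fpc₀⁻
          (θ , θm⁺ , θg⁺φ⁻¹) = pushout-unique
                                 (IsPushout-resp refl φm⁻ refl refl (IsPushout-iso-leg po₀⁺ φ))
                                 (IsPushout-sym po⁺)
      in IsPushout-resp refl φm⁻ refl (trans (sym k⁻φ ⟩∘ from φ) (cancelʳ (to∘from φ)))
           (IsPushout-iso-leg po₀⁻ φ) ,
         IsFPC-resp refl θm⁺ φm⁻ θg⁺φ⁻¹ (IsFPC-iso-target (IsFPC-iso-complement fpc₀⁺ φ) θ)

  restriction-arrows : ∀ {L₀ P₀ R₀ G G⁻ G⁺ H Pᴴ L}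
    {r⁻ : Hom P₀ L₀} {r⁺ : Hom P₀ R₀} {m₀ : Hom L₀ G} {m⁻ : Hom P₀ G⁻} {g⁻ : Hom G⁻ G} {g⁺ : Hom G⁻ G⁺}
    {m⁺ : Hom R₀ G⁺} {rᴴ : Hom R₀ H} {mᴴ : Hom H G⁺} {pᴴ : Hom P₀ Pᴴ} {h⁺ : Hom Pᴴ H}
    {lᴴ : Hom L₀ L} {h⁻ : Hom Pᴴ L} →
    ReversibleSqPO r⁻ r⁺ m₀ m⁻ g⁻ g⁺ m⁺ → Mono mᴴ → mᴴ ∘ rᴴ ≡ m⁺ →
    IsFPC r⁺ rᴴ pᴴ h⁺ → IsPushout r⁻ pᴴ lᴴ h⁻ →
    Σ (Hom Pᴴ G⁻) λ mᴴ₀ → (mᴴ₀ ∘ pᴴ ≡ m⁻) × (g⁺ ∘ mᴴ₀ ≡ mᴴ ∘ h⁺) ×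
    Σ (Hom L G) λ m → (m ∘ lᴴ ≡ m₀) × (m ∘ h⁻ ≡ g⁻ ∘ mᴴ₀)
  restriction-arrows {r⁻ = r⁻} {r⁺ = r⁺} {m₀ = m₀} {m⁻ = m⁻} {g⁻ = g⁻} {mᴴ = mᴴ} {pᴴ = pᴴ} {h⁺ = h⁺}
                     ((_ , left-po) , (right-fpc , _)) mᴴ-mono mᴴrᴴ fpcᴴ poᴸ =
    let (mᴴ₀ , (mᴴ₀pᴴ , g⁺mᴴ₀) , _) = proj₂ right-fpc pᴴ r⁺ (mᴴ ∘ h⁺)
          (IsPullback-resp mᴴrᴴ refl refl refl (IsPullback-postcompose-mono mᴴ-mono (proj₁ fpcᴴ)))
          id (identityʳ r⁺)
        mᴴ₀pᴴ≡m⁻ = trans mᴴ₀pᴴ (identityʳ m⁻)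
        (m , (mlᴴ , mh⁻) , _) = proj₂ poᴸ m₀ (g⁻ ∘ mᴴ₀)
          (trans (proj₁ left-po) (trans (g⁻ ∘⟨ sym mᴴ₀pᴴ≡m⁻) (sym ∘-assoc)))
    in mᴴ₀ , mᴴ₀pᴴ≡m⁻ , g⁺mᴴ₀ , m , mlᴴ , mh⁻

  cube-face-fpc : ∀ {P P₁ P₂ H G G₁ G₂ X}
    {h₁ : Hom P₁ H} {h₂ : Hom P₂ H} {p₁ : Hom P P₁} {p₂ : Hom P P₂}
    {g₁ : Hom G₁ G} {g₂ : Hom G₂ G} {q₁ : Hom X G₁} {q₂ : Hom X G₂}
    {mᴴ : Hom H G} {k₁ : Hom P₁ G₁} {k₂ : Hom P₂ G₂} {n : Hom P X} →
    IsPullback h₁ h₂ p₁ p₂ → IsPullback g₁ g₂ q₁ q₂ → IsPullback mᴴ g₁ h₁ k₁ → IsFPC h₂ mᴴ k₂ g₂ →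
    q₁ ∘ n ≡ k₁ ∘ p₁ → q₂ ∘ n ≡ k₂ ∘ p₂ → IsFPC p₁ k₁ n q₁
  cube-face-fpc {h₁ = h₁} {h₂ = h₂} {p₁ = p₁} {p₂ = p₂} {g₁ = g₁} {g₂ = g₂} {q₁ = q₁} {q₂ = q₂}
                {mᴴ = mᴴ} {k₁ = k₁} {k₂ = k₂} {n = n}
                top bottom side₁ (side₂ , final₂) q₁n q₂n =
    (sym q₁n , λ u v k₁u≡q₁v →
      let (t , (h₂t , k₂t) , unique-t) = proj₂ side₂ (h₁ ∘ u) (q₂ ∘ v) (begin
            mᴴ ∘ (h₁ ∘ u)   ≡⟨ extendʳ (proj₁ side₁) ⟩
            g₁ ∘ (k₁ ∘ u)   ≡⟨ g₁ ∘⟨ k₁u≡q₁v ⟩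
            g₁ ∘ (q₁ ∘ v)   ≡⟨ extendʳ (proj₁ bottom) ⟩
            g₂ ∘ (q₂ ∘ v)   ∎)
          (z , (p₁z , p₂z) , unique-z) = proj₂ top u t (sym h₂t)
          nz≡v = pullback-jointly-monic bottom
                   (trans (pullˡ q₁n) (trans ∘-assoc (trans (k₁ ∘⟨ p₁z) k₁u≡q₁v)))
                   (trans (pullˡ q₂n) (trans ∘-assoc (trans (k₂ ∘⟨ p₂z) k₂t)))
      in z , (p₁z , nz≡v) ,
         λ z′ p₁z′ nz′ → unique-z z′ p₁z′
           (unique-t (p₂ ∘ z′) (trans (pullˡ (sym (proj₁ top))) (pullʳ p₁z′))
                               (trans (pullˡ (sym q₂n)) (pullʳ nz′)))) ,
    λ a′ b′ d′ pb′ e p₁e≡b′ →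
      let (w , (wa′ , g₂w) , unique-w) = final₂ a′ (h₁ ∘ b′) (g₁ ∘ d′) (pullback-paste side₁ pb′) (p₂ ∘ e)
            (trans (pullˡ (sym (proj₁ top))) (pullʳ p₁e≡b′))
          (g , (q₁g , q₂g) , unique-g) = proj₂ bottom d′ w (sym g₂w)
          ga′≡ne = pullback-jointly-monic bottom
            (begin
              q₁ ∘ (g ∘ a′)   ≡⟨ pullˡ q₁g ⟩
              d′ ∘ a′         ≡⟨ sym (proj₁ pb′) ⟩
              k₁ ∘ b′         ≡⟨ k₁ ∘⟨ sym p₁e≡b′ ⟩
              k₁ ∘ (p₁ ∘ e)   ≡⟨ extendʳ (sym q₁n) ⟩
              q₁ ∘ (n ∘ e)    ∎)
            (trans (pullˡ q₂g) (trans wa′ (extendʳ (sym q₂n))))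
      in g , (ga′≡ne , q₁g) ,
         λ h ha′ q₁h → unique-g h q₁h
           (unique-w (q₂ ∘ h) (trans (pullʳ ha′) (extendʳ q₂n))
                              (trans (pullˡ (sym (proj₁ bottom))) (pullʳ q₁h)))

module Adhesivity {o ℓ : Level} (𝒞 : Category o ℓ) (adhesive : Notions.Adhesive 𝒞) where
  open Category 𝒞
  open Notions 𝒞
  open Squares 𝒞
  open ≡-Reasoning

  private variable
    A B C D Y : Obj
    f g h l m n r u v w x y : Hom A B

  private
    pullbacks : HasPullbacks
    pullbacks = proj₁ adhesive

    van-kampen : ∀ {A B C D} (f : Hom A B) (m : Hom A C) (g : Hom B D) (n : Hom C D) →
                 Mono m → IsPushout f m g n → IsVanKampen f m g n
    van-kampen = proj₂ (proj₂ adhesive)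

  -- Van Kampen for the cube from the trivial pushout of f and id: its back faces are
  -- trivial and the kernel pair of m, its front faces the kernel pair of g and the square itself.
  pushout-along-mono : Mono m → IsPushout f m g n → Mono g × IsPullback n g m f
  pushout-along-mono {m = m} {f = f} {g = g} {n = n} m-mono po =
    let (g-kernel-pair , pb) = proj₁ (proj₂ (van-kampen f m g n m-mono po) f id id f id id m g
                                 (sym id-comm) refl (sym (proj₁ po)) IsPullback-id (mono⇒IsPullback-id m-mono))
                                 IsPushout-id
    in IsPullback-id⇒mono g-kernel-pair , pb

  reversible-comatch-mono : ∀ {L P R G G⁻ G⁺} {r⁻ : Hom P L} {r⁺ : Hom P R} {m : Hom L G}
    {m⁻ : Hom P G⁻} {g⁻ : Hom G⁻ G} {g⁺ : Hom G⁻ G⁺} {m⁺ : Hom R G⁺} →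
    Mono m → ReversibleSqPO r⁻ r⁺ m m⁻ g⁻ g⁺ m⁺ → Mono m⁺
  reversible-comatch-mono m-mono ((left-fpc , _) , (_ , right-po)) =
    proj₁ (pushout-along-mono (mono-pullback-stable (proj₁ left-fpc) m-mono) right-po)

  -- By van Kampen, pulling the pushout back along w gives a pushout again.
  pulled-back-pushout-jointly-epic : ∀ {YB YC} {πB : Hom YB B} {iB : Hom YB Y} {πC : Hom YC C} {iC : Hom YC Y} →
    Mono m → IsPushout f m g n → IsPullback g w πB iB → IsPullback n w πC iC →
    u ∘ iB ≡ v ∘ iB → u ∘ iC ≡ v ∘ iC → u ≡ v
  pulled-back-pushout-jointly-epic {m = m} {f = f} {g = g} {n = n} {w = w} {πB = πB} {iB = iB} {πC = πC} {iC = iC}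
                                   m-mono po pbB pbC uiB≡viB uiC≡viC =
    let (_ , a , f′ , pbA) = pullbacks f πB
        (m′ , (πCm′ , iCm′) , _) = proj₂ pbC (m ∘ a) (iB ∘ f′) (begin
          n ∘ (m ∘ a)      ≡⟨ pullˡ (sym (proj₁ po)) ⟩
          (g ∘ f) ∘ a      ≡⟨ pullʳ (proj₁ pbA) ⟩
          g ∘ (πB ∘ f′)    ≡⟨ extendʳ (proj₁ pbB) ⟩
          w ∘ (iB ∘ f′)    ∎)
        outer : IsPullback w (n ∘ m) (iC ∘ m′) a
        outer = IsPullback-resp refl (proj₁ po) (sym iCm′) refl
                  (pullback-paste (IsPullback-sym pbB) (IsPullback-sym pbA))
        back : IsPullback m πC a m′
        back = IsPullback-sym (pullback-decompose outer (IsPullback-sym pbC) πCm′)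
        top : IsPushout f′ m′ iB iC
        top = proj₂ (proj₂ (van-kampen f m g n m-mono po) f′ m′ iB iC a πB πC w
                (sym iCm′) (proj₁ pbB) (proj₁ pbC) pbA back) (pbB , pbC)
    in pushout-jointly-epic top uiB≡viB uiC≡viC

  union-factorises : ∀ {ρ : Hom Y B} →
    Mono m → IsPullback m n x y → Mono y → IsPushout x y r l → h ∘ r ≡ m → h ∘ l ≡ n →
    h ∘ w ≡ m ∘ ρ → w ≡ r ∘ ρ
  union-factorises {m = m} {n = n} {x = x} {y = y} {r = r} {l = l} {h = h} {w = w} {ρ = ρ}
                   m-mono pb y-mono po hr hl hw =
    let (_ , πB , iB , pbB) = pullbacks r w
        (_ , πC , iC , pbC) = pullbacks l w
        πB≡ρiB : πB ≡ ρ ∘ iB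
        πB≡ρiB = m-mono _ _ (begin
          m ∘ πB          ≡⟨ sym (pullˡ hr) ⟩
          h ∘ (r ∘ πB)    ≡⟨ h ∘⟨ proj₁ pbB ⟩
          h ∘ (w ∘ iB)    ≡⟨ extendʳ hw ⟩
          m ∘ (ρ ∘ iB)    ∎)
        (δ , (xδ , yδ) , _) = proj₂ pb (ρ ∘ iC) πC (begin
          m ∘ (ρ ∘ iC)    ≡⟨ extendʳ (sym hw) ⟩
          h ∘ (w ∘ iC)    ≡⟨ h ∘⟨ sym (proj₁ pbC) ⟩
          h ∘ (l ∘ πC)    ≡⟨ pullˡ hl ⟩
          n ∘ πC          ∎)
    in pulled-back-pushout-jointly-epic y-mono po pbB pbC
         (trans (sym (proj₁ pbB)) (trans (r ∘⟨ πB≡ρiB) (sym ∘-assoc)))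
         (begin
           w ∘ iC          ≡⟨ sym (proj₁ pbC) ⟩
           l ∘ πC          ≡⟨ l ∘⟨ sym yδ ⟩
           l ∘ (y ∘ δ)     ≡⟨ extendʳ (sym (proj₁ po)) ⟩
           r ∘ (x ∘ δ)     ≡⟨ r ∘⟨ xδ ⟩
           r ∘ (ρ ∘ iC)    ≡⟨ sym ∘-assoc ⟩
           (r ∘ ρ) ∘ iC    ∎)

  union-mono : Mono m → Mono n → IsPullback m n x y → IsPushout x y r l → h ∘ r ≡ m → h ∘ l ≡ n → Mono h
  union-mono {r = r} {l = l} {h = h} m-mono n-mono pb po hr hl u v hu≡hv =
    let x-mono = mono-pullback-stable (IsPullback-sym pb) n-mono
        y-mono = mono-pullback-stable pb m-mono
        (_ , πB , iB , pbB) = pullbacks r u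
        (_ , πC , iC , pbC) = pullbacks l u
        v-on-B : v ∘ iB ≡ r ∘ πB
        v-on-B = union-factorises m-mono pb y-mono po hr hl
                   (trans (pullˡ (sym hu≡hv)) (trans ∘-assoc (trans (h ∘⟨ sym (proj₁ pbB)) (pullˡ hr))))
        v-on-C : v ∘ iC ≡ l ∘ πC
        v-on-C = union-factorises n-mono (IsPullback-sym pb) x-mono (IsPushout-sym po) hl hr
                   (trans (pullˡ (sym hu≡hv)) (trans ∘-assoc (trans (h ∘⟨ sym (proj₁ pbC)) (pullˡ hl))))
    in pulled-back-pushout-jointly-epic y-mono po pbB pbC
         (trans (sym (proj₁ pbB)) (sym v-on-B)) (trans (sym (proj₁ pbC)) (sym v-on-C))

  -- The pushout half is van Kampen for the cube over the pushout face (h₂, k₂, mᴴ, g₂).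
  cube-face-fpc-pushout : ∀ {P P₁ P₂ H G G₁ G₂ X}
    {h₁ : Hom P₁ H} {h₂ : Hom P₂ H} {p₁ : Hom P P₁} {p₂ : Hom P P₂}
    {g₁ : Hom G₁ G} {g₂ : Hom G₂ G} {q₁ : Hom X G₁} {q₂ : Hom X G₂}
    {mᴴ : Hom H G} {k₁ : Hom P₁ G₁} {k₂ : Hom P₂ G₂} {n : Hom P X} →
    IsPullback h₁ h₂ p₁ p₂ → IsPullback g₁ g₂ q₁ q₂ → IsFPCPushout h₁ mᴴ k₁ g₁ → IsFPCPushout h₂ mᴴ k₂ g₂ →
    Mono mᴴ → q₁ ∘ n ≡ k₁ ∘ p₁ → q₂ ∘ n ≡ k₂ ∘ p₂ → IsFPCPushout p₁ k₁ n q₁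
  cube-face-fpc-pushout {h₁ = h₁} {h₂ = h₂} {p₁ = p₁} {p₂ = p₂} {g₁ = g₁} {g₂ = g₂} {q₁ = q₁} {q₂ = q₂}
                        {mᴴ = mᴴ} {k₁ = k₁} {k₂ = k₂} {n = n}
                        top bottom (fpc₁ , _) (fpc₂ , po₂) mᴴ-mono q₁n q₂n =
    let face₂ = cube-face-fpc (IsPullback-sym top) (IsPullback-sym bottom) (proj₁ fpc₂) fpc₁ q₂n q₁n
    in cube-face-fpc top bottom (proj₁ fpc₁) fpc₂ q₁n q₂n ,
       proj₂ (proj₂ (van-kampen h₂ k₂ mᴴ g₂ (mono-pullback-stable (proj₁ fpc₂) mᴴ-mono) po₂)
                p₁ n k₁ q₁ p₂ h₁ q₂ g₁ (sym q₁n) (proj₁ (proj₁ fpc₁)) (sym (proj₁ bottom))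
                (IsPullback-sym top) (proj₁ face₂))
         (proj₁ fpc₁ , IsPullback-sym bottom)

  reversible-sequential-composition : ∀ {L P P₁ P₂ H R G₁ G₁⁻ G₂ G₂⁻ G₃}
    {h₁⁻ : Hom P₁ L} {h₁⁺ : Hom P₁ H} {h₂⁻ : Hom P₂ H} {h₂⁺ : Hom P₂ R} {p₁ : Hom P P₁} {p₂ : Hom P P₂}
    {m : Hom L G₁} {k₁ : Hom P₁ G₁⁻} {g₁⁻ : Hom G₁⁻ G₁} {g₁⁺ : Hom G₁⁻ G₂} {mᴴ : Hom H G₂}
    {k₂ : Hom P₂ G₂⁻} {g₂⁻ : Hom G₂⁻ G₂} {g₂⁺ : Hom G₂⁻ G₃} {mᴿ : Hom R G₃} →
    Mono mᴴ → IsPullback h₁⁺ h₂⁻ p₁ p₂ →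
    ReversibleSqPO h₁⁻ h₁⁺ m k₁ g₁⁻ g₁⁺ mᴴ → ReversibleSqPO h₂⁻ h₂⁺ mᴴ k₂ g₂⁻ g₂⁺ mᴿ →
    Σ Obj λ X → Σ (Hom P X) λ n → Σ (Hom X G₁) λ k⁻ → Σ (Hom X G₃) λ k⁺ →
      ReversibleSqPO (h₁⁻ ∘ p₁) (h₂⁺ ∘ p₂) m n k⁻ k⁺ mᴿ
  reversible-sequential-composition {h₁⁺ = h₁⁺} {h₂⁻ = h₂⁻} {p₁ = p₁} {p₂ = p₂} {k₁ = k₁} {g₁⁻ = g₁⁻}
                                    {g₁⁺ = g₁⁺} {mᴴ = mᴴ} {k₂ = k₂} {g₂⁻ = g₂⁻} {g₂⁺ = g₂⁺}
                                    mᴴ-mono top (left₁ , right₁) (left₂ , right₂) =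
    let (X , q₁ , q₂ , bottom) = pullbacks g₁⁺ g₂⁻
        (n , (q₁n , q₂n) , _) = proj₂ bottom (k₁ ∘ p₁) (k₂ ∘ p₂) (begin
          g₁⁺ ∘ (k₁ ∘ p₁)   ≡⟨ extendʳ (sym (proj₁ (proj₁ (proj₁ right₁)))) ⟩
          mᴴ ∘ (h₁⁺ ∘ p₁)   ≡⟨ mᴴ ∘⟨ proj₁ top ⟩
          mᴴ ∘ (h₂⁻ ∘ p₂)   ≡⟨ extendʳ (proj₁ (proj₁ (proj₁ left₂))) ⟩
          g₂⁻ ∘ (k₂ ∘ p₂)   ∎)
        face₁ = cube-face-fpc-pushout top bottom right₁ left₂ mᴴ-mono q₁n q₂n
        face₂ = cube-face-fpc-pushout (IsPullback-sym top) (IsPullback-sym bottom) left₂ right₁ mᴴ-mono q₂n q₁n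
    in X , n , g₁⁻ ∘ q₁ , g₂⁺ ∘ q₂ , fpc-pushout-pasteʰ face₁ left₁ , fpc-pushout-pasteʰ face₂ right₂

  module _ (fpcs : HasFPCsAlongMonos) where

    -- The upper square is a pushout by van Kampen for the cube over the outer pushout.
    fpc-pushout-lower-from-fpc : ∀ {B₂ D₁} {b : Hom A B} {c₁ : Hom B B₂} {c₂ : Hom B₂ C} {a : Hom A D}
      {d : Hom D C} {a₁ : Hom A D₁} {d₁ : Hom D₁ B₂} {k : Hom D₁ D} →
      IsFPCPushout b (c₂ ∘ c₁) a d → Mono a → Mono c₂ → IsFPC b c₁ a₁ d₁ →
      k ∘ a₁ ≡ a → d ∘ k ≡ c₂ ∘ d₁ → IsFPCPushout d₁ c₂ k d
    fpc-pushout-lower-from-fpc {b = b} {c₁ = c₁} {c₂ = c₂} {a = a} {d = d} {a₁ = a₁} {d₁ = d₁} {k = k}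
                               (outer-fpc , outer-po) a-mono c₂-mono upper ka₁ dk =
      let lower = fpc-decomposeᵛ-lower pullbacks fpcs upper c₂-mono outer-fpc ka₁ dk
          k-mono = mono-pullback-stable (proj₁ lower) c₂-mono
          upper-po : IsPushout b a₁ c₁ d₁
          upper-po = proj₂ (proj₂ (van-kampen b a (c₂ ∘ c₁) d a-mono outer-po) b a₁ c₁ d₁ id id k c₂
                       (proj₁ (proj₁ upper)) (identityʳ (c₂ ∘ c₁)) dk IsPullback-id
                       (IsPullback-resp ka₁ refl refl refl (mono⇒IsPullback-∘ k-mono)))
                       (mono⇒IsPullback-∘ c₂-mono , IsPullback-sym (proj₁ lower))
      in lower ,
         pushout-decomposeᵛ-lower outer-po upper-po ka₁ dk

    fpc-pushout-lower-from-pushout : ∀ {B₂ D₁} {b : Hom A B} {c₁ : Hom B B₂} {c₂ : Hom B₂ C} {a : Hom A D}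
      {d : Hom D C} {a₁ : Hom A D₁} {d₁ : Hom D₁ B₂} {k : Hom D₁ D} →
      IsFPCPushout b (c₂ ∘ c₁) a d → IsPushout b a₁ c₁ d₁ → Mono a₁ → Mono k →
      k ∘ a₁ ≡ a → d ∘ k ≡ c₂ ∘ d₁ → Mono c₂ × IsFPCPushout d₁ c₂ k d
    fpc-pushout-lower-from-pushout (outer-fpc , outer-po) upper-po a₁-mono k-mono ka₁ dk =
      let lower-po = pushout-decomposeᵛ-lower outer-po upper-po ka₁ dk
          (c₂-mono , lower-pb) = pushout-along-mono k-mono lower-po
          upper = fpc-decomposeᵛ-upper outer-fpc (IsPullback-sym (proj₂ (pushout-along-mono a₁-mono upper-po)))
                    (IsPullback-sym lower-pb) c₂-mono k-mono ka₁
      in c₂-mono , fpc-decomposeᵛ-lower pullbacks fpcs upper c₂-mono outer-fpc ka₁ dk , lower-po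

    reversible-restriction : ∀ {L₀ P₀ R₀ G G⁻ G⁺ H Pᴴ L}
      {r⁻ : Hom P₀ L₀} {r⁺ : Hom P₀ R₀} {m₀ : Hom L₀ G} {m⁻ : Hom P₀ G⁻} {g⁻ : Hom G⁻ G} {g⁺ : Hom G⁻ G⁺}
      {m⁺ : Hom R₀ G⁺} {rᴴ : Hom R₀ H} {mᴴ : Hom H G⁺} {pᴴ : Hom P₀ Pᴴ} {h⁺ : Hom Pᴴ H}
      {lᴴ : Hom L₀ L} {h⁻ : Hom Pᴴ L} {mᴴ₀ : Hom Pᴴ G⁻} {m : Hom L G} →
      Mono m₀ → ReversibleSqPO r⁻ r⁺ m₀ m⁻ g⁻ g⁺ m⁺ →
      Mono rᴴ → Mono mᴴ → mᴴ ∘ rᴴ ≡ m⁺ → IsFPC r⁺ rᴴ pᴴ h⁺ → IsPushout r⁻ pᴴ lᴴ h⁻ →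
      mᴴ₀ ∘ pᴴ ≡ m⁻ → g⁺ ∘ mᴴ₀ ≡ mᴴ ∘ h⁺ → m ∘ lᴴ ≡ m₀ → m ∘ h⁻ ≡ g⁻ ∘ mᴴ₀ →
      Mono m × ReversibleSqPO h⁻ h⁺ m mᴴ₀ g⁻ g⁺ mᴴ
    reversible-restriction {r⁻ = r⁻} {r⁺ = r⁺} {m⁻ = m⁻} {g⁻ = g⁻} {g⁺ = g⁺}
                           m₀-mono (left , right) rᴴ-mono mᴴ-mono mᴴrᴴ fpcᴴ poᴸ mᴴ₀pᴴ g⁺mᴴ₀ mlᴴ mh⁻ =
      let m⁻-mono = mono-pullback-stable (proj₁ (proj₁ left)) m₀-mono
          right′ = fpc-pushout-lower-from-fpc (subst (λ c → IsFPCPushout r⁺ c m⁻ g⁺) (sym mᴴrᴴ) right)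
                     m⁻-mono mᴴ-mono fpcᴴ mᴴ₀pᴴ g⁺mᴴ₀
          (m-mono , left′) = fpc-pushout-lower-from-pushout
                               (subst (λ c → IsFPCPushout r⁻ c m⁻ g⁻) (sym mlᴴ) left) poᴸ
                               (mono-pullback-stable (proj₁ fpcᴴ) rᴴ-mono)
                               (mono-pullback-stable (proj₁ (proj₁ right′)) mᴴ-mono) mᴴ₀pᴴ (sym mh⁻)
      in m-mono , left′ , right′
proposition1 :
  ∀ {o ℓ : Level} (𝒞 : Category o ℓ) →
  let open Category 𝒞
      open Notions 𝒞
  in
  Adhesive → HasPushouts → HasFPCsAlongMonos →
  -- first rule, instance and its SqPO rewriting (assumed reversible)
  ∀ {L₁ P₁ R₁ G₁ G₁⁻ G₂} (r₁⁻ : Hom P₁ L₁) (r₁⁺ : Hom P₁ R₁)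
    (m₁ : Hom L₁ G₁) → Mono m₁ →
    (m₁⁻ : Hom P₁ G₁⁻) (g₁⁻ : Hom G₁⁻ G₁) (g₁⁺ : Hom G₁⁻ G₂) (m₁⁺ : Hom R₁ G₂) →
    IsSqPO r₁⁻ r₁⁺ m₁ m₁⁻ g₁⁻ g₁⁺ m₁⁺ →
    Reversible r₁⁻ r₁⁺ m₁ m₁⁻ g₁⁻ g₁⁺ m₁⁺ →
  -- second rule, instance in G₂ and its SqPO rewriting (assumed reversible)
  ∀ {L₂ P₂ R₂ G₂⁻ G₃} (r₂⁻ : Hom P₂ L₂) (r₂⁺ : Hom P₂ R₂)
    (m₂ : Hom L₂ G₂) → Mono m₂ →
    (m₂⁻ : Hom P₂ G₂⁻) (g₂⁻ : Hom G₂⁻ G₂) (g₂⁺ : Hom G₂⁻ G₃) (m₂⁺ : Hom R₂ G₃) →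
    IsSqPO r₂⁻ r₂⁺ m₂ m₂⁻ g₂⁻ g₂⁺ m₂⁺ →
    Reversible r₂⁻ r₂⁺ m₂ m₂⁻ g₂⁻ g₂⁺ m₂⁺ →
  -- (1) pullback of m₁⁺ and m₂
  ∀ {D} (x : Hom D R₁) (y : Hom D L₂) → IsPullback m₁⁺ m₂ x y →
  -- (2) pushout of x and y, and the induced arrow mᴴ
  ∀ {H} (r₁ᴴ : Hom R₁ H) (l₂ᴴ : Hom L₂ H) → IsPushout x y r₁ᴴ l₂ᴴ →
  ∀ (mᴴ : Hom H G₂) → mᴴ ∘ r₁ᴴ ≡ m₁⁺ → mᴴ ∘ l₂ᴴ ≡ m₂ →
  -- (3) final pullback complements
  ∀ {P₁ᴴ} (p₁ᴴ : Hom P₁ P₁ᴴ) (h₁⁺ : Hom P₁ᴴ H) → IsFPC r₁⁺ r₁ᴴ p₁ᴴ h₁⁺ →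
  ∀ {P₂ᴴ} (p₂ᴴ : Hom P₂ P₂ᴴ) (h₂⁻ : Hom P₂ᴴ H) → IsFPC r₂⁻ l₂ᴴ p₂ᴴ h₂⁻ →
  -- (4) pushouts
  ∀ {L} (l₁ᴴ : Hom L₁ L) (h₁⁻ : Hom P₁ᴴ L) → IsPushout r₁⁻ p₁ᴴ l₁ᴴ h₁⁻ →
  ∀ {R} (r₂ᴴ : Hom R₂ R) (h₂⁺ : Hom P₂ᴴ R) → IsPushout r₂⁺ p₂ᴴ r₂ᴴ h₂⁺ →
  -- (5) pullback of h₁⁺ and h₂⁻
  ∀ {P} (p′ : Hom P P₁ᴴ) (p″ : Hom P P₂ᴴ) → IsPullback h₁⁺ h₂⁻ p′ p″ →
  -- the arrows m₁ᴴ and m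
  ∀ (m₁ᴴ : Hom P₁ᴴ G₁⁻) → m₁ᴴ ∘ p₁ᴴ ≡ m₁⁻ → g₁⁺ ∘ m₁ᴴ ≡ mᴴ ∘ h₁⁺ →
  ∀ (m : Hom L G₁) → m ∘ l₁ᴴ ≡ m₁ → m ∘ h₁⁻ ≡ g₁⁻ ∘ m₁ᴴ →
  -- conclusion: m is a mono, and the SqPO rewriting of G₁ by the composed
  -- rule  L ←(h₁⁻ ∘ p′)− P −(h₂⁺ ∘ p″)→ R  through m is reversible
  Mono m ×
  (∀ {G⁻ G⁺} (n⁻ : Hom P G⁻) (k⁻ : Hom G⁻ G₁) (k⁺ : Hom G⁻ G⁺) (n⁺ : Hom R G⁺) →
     IsSqPO (h₁⁻ ∘ p′) (h₂⁺ ∘ p″) m n⁻ k⁻ k⁺ n⁺ →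
     Reversible (h₁⁻ ∘ p′) (h₂⁺ ∘ p″) m n⁻ k⁻ k⁺ n⁺)
proposition1 𝒞 adhesive _ fpcs _ _ _ m₁-mono _ _ _ _ sqpo₁ rev₁ _ _ _ m₂-mono _ _ _ _ sqpo₂ rev₂
             _ _ D-pullback _ _ H-pushout _ mᴴr₁ᴴ mᴴl₂ᴴ _ _ fpc₁ᴴ _ _ fpc₂ᴴ _ _ L-pushout _ _ R-pushout
             _ _ P-pullback _ m₁ᴴp₁ᴴ g₁⁺m₁ᴴ _ ml₁ᴴ mh₁⁻ =
  let step₁ = reversibleSqPO sqpo₁ rev₁
      step₂ = reversibleSqPO sqpo₂ rev₂
      m₁⁺-mono = reversible-comatch-mono m₁-mono step₁
      m₂⁺-mono = reversible-comatch-mono m₂-mono step₂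
      r₁ᴴ-mono = proj₁ (pushout-along-mono (mono-pullback-stable D-pullback m₁⁺-mono) H-pushout)
      l₂ᴴ-mono = proj₁ (pushout-along-mono (mono-pullback-stable (IsPullback-sym D-pullback) m₂-mono)
                                            (IsPushout-sym H-pushout))
      mᴴ-mono = union-mono m₁⁺-mono m₂-mono D-pullback H-pushout mᴴr₁ᴴ mᴴl₂ᴴ
      (m-mono , step₁ᴴ) = reversible-restriction fpcs m₁-mono step₁ r₁ᴴ-mono mᴴ-mono mᴴr₁ᴴ fpc₁ᴴ L-pushout
                            m₁ᴴp₁ᴴ g₁⁺m₁ᴴ ml₁ᴴ mh₁⁻
      (_ , m₂ᴴp₂ᴴ , g₂⁻m₂ᴴ , _ , mᴿr₂ᴴ , mᴿh₂⁺) = restriction-arrows (swap step₂) mᴴ-mono mᴴl₂ᴴ fpc₂ᴴ R-pushout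
      (_ , step₂ᴴ) = reversible-restriction fpcs m₂⁺-mono (swap step₂) l₂ᴴ-mono mᴴ-mono mᴴl₂ᴴ fpc₂ᴴ R-pushout
                       m₂ᴴp₂ᴴ g₂⁻m₂ᴴ mᴿr₂ᴴ mᴿh₂⁺
      (_ , _ , _ , _ , composite) = reversible-sequential-composition mᴴ-mono P-pullback step₁ᴴ (swap step₂ᴴ)
  in m-mono , λ _ _ _ _ sqpo → reversible-invariant sqpo composite
  where
  open Squares 𝒞
  open Adhesivity 𝒞 adhesive
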